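{- Let $\mathcal{L}=(\Sigma,R)$ be a finitely nested $\lambda$-TRS. For all unary contexts $C$ over $\Sigma$, all terms $s,t$ over $\Sigma$, and all $d\in\mathbb{N}$: (1) if $|s|_\lambda\le |t|_\lambda + d$, then $|C[s]|_\lambda\le |C[t]|_\lambda + d$; (2) if $|s|_\lambda = |t|_\lambda$, then $|C[s]|_\lambda = |C[t]|_\lambda$.
   Context: A $\lambda$-TRS is a pair $\mathcal{L}=(\Sigma,R)$ where $\Sigma$ is a signature containing the binary application symbol $@$; the symbols in $\Sigma^-:=\Sigma\setminus\{@\}$ are called scope symbols, and $R$ contains, for each scope symbol $f$ of arity $k$, exactly one (defining) rule $@(f(x_1,\dots,x_k),y)\to F(x_1,\dots,x_k,y)$, where $F$ is a $(k+1)$-ary context over $\Sigma$, the scope context of $f$. A scope symbol $f$ depends on $g$ if $g$ occurs in the scope context of $f$; $\mathcal{L}$ is finitely nested if there is no infinite chain $f_0,f_1,f_2,\dots$ of scope symbols with each $f_m$ depending on $f_{m+1}$. A unary context is a term over $\Sigma$ with a hole $\Box$; $C[s]$ is the result of filling the hole with $s$. Let $\Sigma_\lambda$ consist of constants $v_j$ ($j\in\mathbb{N}$), $@$, and unary named-abstraction symbols $\lambda v_j$ ($j\in\mathbb{N}$), disjoint from $\Sigma^-$. Expansion: add unary symbols $\mathit{exp}_i$ ($i\in\mathbb{N}$) with rules $\mathit{exp}_i(@(x_1,x_2))\to @(\mathit{exp}_i(x_1),\mathit{exp}_i(x_2))$; $\mathit{exp}_i(f(x_1,\dots,x_k))\to\lambda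 v_i(\mathit{exp}_{i+1}(F(x_1,\dots,x_k,v_i)))$ for each scope symbol $f$ with scope context $F$; $\mathit{exp}_i(v_j)\to v_j$; $\mathit{exp}_i(\lambda v_j(x))\to\lambda v_j(\mathit{exp}_{\max\{i,j\}+1}(x))$. For a term $t$, $[\![t]\!]$ is the unique (finite or infinite) normal form of $\mathit{exp}_0(t)$, and the $\lambda$-term depth $|t|_\lambda\in\mathbb{N}\cup\{\infty\}$ is the depth (longest root-to-leaf path length) of $[\![t]\!]$, where term variables (and residual $\mathit{exp}_i(x)$ for a variable $x$) have depth $0$. -}

module Defs where

open import Data.Nat using (ℕ; zero; suc; _+_; _⊔_)
open import Data.Fin using (Fin; _≟_)
open import Data.Sum using (_⊎_; inj₁; inj₂)
open import Data.Product using (Σ; _×_; ∃)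
open import Data.Unit using (⊤; tt)
open import Data.Empty using (⊥)
open import Relation.Nullary using (¬_; yes; no)
open import Relation.Binary.PropositionalEquality using (_≡_)

data Tm (Sym : Set) (ar : Sym → ℕ) (V : Set) : Set where
  var : V → Tm Sym ar V
  app : Tm Sym ar V → Tm Sym ar V → Tm Sym ar V
  fun : (f : Sym) → (Fin (ar f) → Tm Sym ar V) → Tm Sym ar V

-- λ-TRS: for every scope symbol f of arity k its scope context
-- F f, a (k+1)-ary context over Σ in the variables x₁..x_k (inj₁ i)
-- and y (inj₂ tt).  The defining rule is  @(f(x₁..x_k), y) → F(x₁..x_k, y).

record LTRS : Set₁ where
  field
    Sym   : Set
    ar    : Sym → ℕ
    scope : (f : Sym) → Tm Sym ar (Fin (ar f) ⊎ ⊤)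

module _ (L : LTRS) where
  open LTRS L

  Term : Set
  Term = Tm Sym ar ℕ

  Occurs : {W : Set} → Sym → Tm Sym ar W → Set
  Occurs g (var x)   = ⊥
  Occurs g (app a b) = Occurs g a ⊎ Occurs g b
  Occurs g (fun f as) = (f ≡ g) ⊎ Σ (Fin (ar f)) (λ i → Occurs g (as i))

  Depends : Sym → Sym → Set
  Depends f g = Occurs g (scope f)

  FinitelyNested : Set
  FinitelyNested = ¬ (Σ (ℕ → Sym) λ c → ∀ m → Depends (c m) (c (suc m)))

  data Ctx : Set where
    hole : Ctx
    appL : Ctx → Term → Ctx
    appR : Term → Ctx → Ctx
    funC : (f : Sym) → (i : Fin (ar f)) →
           (Fin (ar f) → Term) → Ctx → Ctx
                                              -- (the i-th entry of the function is ignored)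

  updArg : {k : ℕ} → (Fin k → Term) → Fin k → Term → Fin k → Term
  updArg as i u j with j ≟ i
  ... | yes _ = u
  ... | no _  = as j

  plug : Ctx → Term → Term
  plug hole            s = s
  plug (appL C t)      s = app (plug C s) t
  plug (appR t C)      s = app t (plug C s)
  plug (funC f i as C) s = fun f (updArg as i (plug C s))

  -- Terms over Σ ∪ Σ_λ (Σ_λ: constants v_j and unary λv_j), with variables

  data XTm : Set where
    xvar : ℕ → XTm
    xapp : XTm → XTm → XTm
    xfun : (f : Sym) → (Fin (ar f) → XTm) → XTm
    xv   : ℕ → XTm
    xlam : ℕ → XTm → XTm

  embed : Term → XTm
  embed (var x)    = xvar x
  embed (app a b)  = xapp (embed a) (embed b)
  embed (fun f as) = xfun f (λ i → embed (as i))

  inst : {W : Set} → (W → XTm) → Tm Sym ar W → XTm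
  inst σ (var x)    = σ x
  inst σ (app a b)  = xapp (inst σ a) (inst σ b)
  inst σ (fun f as) = xfun f (λ i → inst σ (as i))

  -- Possibly infinite λ-terms are represented by their finite truncations.
  -- FTree: finite λ-terms over Σ_λ, with a leaf `cut` marking a node whose
  -- subtree has been truncated.

  data FTree : Set where
    cut  : FTree                    -- truncated subtree (a node is present here)
    lres : ℕ → FTree                -- residual exp_i(x) for a term variable x
    lv   : ℕ → FTree
    lapp : FTree → FTree → FTree
    llam : ℕ → FTree → FTree

  -- expandTo n i t : the normal form of exp_i(t), truncated at depth n
  -- (nodes at depth n are replaced by `cut`).  It follows the rules
  --   exp_i(@(x₁,x₂)) → @(exp_i(x₁), exp_i(x₂))
  --   exp_i(f(x₁..x_k)) → λv_i(exp_{i+1}(F(x₁..x_k, v_i)))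
  --   exp_i(v_j) → v_j
  --   exp_i(λv_j(x)) → λv_j(exp_{max{i,j}+1}(x))
  expandTo : ℕ → ℕ → XTm → FTree
  expandTo zero    i t           = cut
  expandTo (suc n) i (xvar x)    = lres x
  expandTo (suc n) i (xapp a b)  = lapp (expandTo n i a) (expandTo n i b)
  expandTo (suc n) i (xfun f as) = llam i (expandTo n (suc i) (inst σ (scope f)))
    where
      σ : Fin (ar f) ⊎ ⊤ → XTm
      σ (inj₁ k) = as k
      σ (inj₂ _) = xv i
  expandTo (suc n) i (xv j)      = lv j
  expandTo (suc n) i (xlam j a)  = llam j (expandTo n (suc (i ⊔ j)) a)

  ⟦_⟧ : Term → ℕ → FTree
  ⟦ t ⟧ n = expandTo n 0 (embed t)

  HasNodeAt : ℕ → FTree → Set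
  HasNodeAt zero    T          = ⊤
  HasNodeAt (suc n) cut        = ⊥
  HasNodeAt (suc n) (lres _)   = ⊥
  HasNodeAt (suc n) (lv _)     = ⊥
  HasNodeAt (suc n) (lapp a b) = HasNodeAt n a ⊎ HasNodeAt n b
  HasNodeAt (suc n) (llam _ a) = HasNodeAt n a

  -- Depth (in ℕ ∪ {∞}) of ⟦ t ⟧, represented by its lower set:
  -- DepthGe n t ⇔ |t|_λ ≥ n ⇔ ⟦t⟧ has a root-to-node path with n edges.
  DepthGe : ℕ → Term → Set
  DepthGe n t = HasNodeAt n (⟦ t ⟧ n)

  -- |s|_λ ≤ |t|_λ + d   (in ℕ ∪ {∞})
  DepthLe+ : Term → Term → ℕ → Set
  DepthLe+ s t d = ∀ n → DepthGe (n + d) s → DepthGe n t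

  -- |s|_λ = |t|_λ   (in ℕ ∪ {∞})
  DepthEq : Term → Term → Set
  DepthEq s t = ∀ n → (DepthGe n s → DepthGe n t) × (DepthGe n t → DepthGe n s)

module Submission where

-- Expansion ⟦_⟧ is compositional: the expansion of C[s] is built
-- from the same nodes as that of C[t], except below the hole, and except
-- for the *indices* of binders λv_j and constants v_j, which depend on the
-- context of a subterm but never on its shape.  We capture this by a
-- relation  Similar B u u'  on extended terms: u and u' have the same
-- skeleton, up to the indices of v_j / λv_j and up to pairs of subterms
-- related by a base relation B.
--
-- The central lemma (transfer) says that depth transfer is inherited from
-- B by Similar B: if every B-related pair (u, u') satisfies "a node at depth
-- m + d in the expansion of u (at any starting index) yields a node at depth
-- m in that of u' (at any index)", then so does every Similar B pair.
-- Taking B empty shows that reachable depth does not depend on the starting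
-- index; taking B = {(s, t)} and observing that plugging into a context
-- yields Similar terms gives part (1), and part (2) is part (1) with d = 0
-- in both directions.  Depth is given by truncations of ⟦_⟧.

open import Defs
open import Data.Nat using (ℕ; zero; suc; _+_)
open import Data.Nat.Properties using (+-identityʳ)
open import Data.Product using (_×_; _,_; proj₁; proj₂)
open import Data.Sum using (inj₁; inj₂)
open import Data.Unit using (tt)
open import Data.Empty using (⊥)
open import Data.Fin using (_≟_)
open import Relation.Nullary using (yes; no)
open import Relation.Binary.PropositionalEquality using (subst; sym)

module _ (L : LTRS) where
  open LTRS L

  Reaches : ℕ → ℕ → XTm L → Set
  Reaches m i u = HasNodeAt L m (expandTo L m i u)

  Transfers : (XTm L → XTm L → Set) → ℕ → Set
  Transfers B d = ∀ m i j {u u'} → B u u' → Reaches (m + d) i u → Reaches m j u'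

  data Similar (B : XTm L → XTm L → Set) : XTm L → XTm L → Set where
    base : ∀ {u u'} → B u u' → Similar B u u'
    var  : ∀ x → Similar B (xvar x) (xvar x)
    app  : ∀ {a a' b b'} → Similar B a a' → Similar B b b' →
           Similar B (xapp a b) (xapp a' b')
    fun  : ∀ f {as as'} → (∀ k → Similar B (as k) (as' k)) →
           Similar B (xfun f as) (xfun f as')
    v    : ∀ j j' → Similar B (xv j) (xv j')
    lam  : ∀ j j' {a a'} → Similar B a a' → Similar B (xlam j a) (xlam j' a')

  similar-refl : ∀ {B} u → Similar B u u
  similar-refl (xvar x)    = var x
  similar-refl (xapp a b)  = app (similar-refl a) (similar-refl b)
  similar-refl (xfun f as) = fun f (λ k → similar-refl (as k))
  similar-refl (xv j)      = v j j
  similar-refl (xlam j a)  = lam j j (similar-refl a)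

  -- Instantiating a context with pointwise Similar substitutions gives
  -- Similar terms; this covers unfolding a scope symbol, where the bound
  -- variable is instantiated by v_i resp. v_j for different indices.
  similar-inst : ∀ {B} {W : Set} (σ σ' : W → XTm L) →
                 (∀ w → Similar B (σ w) (σ' w)) →
                 ∀ c → Similar B (inst L σ c) (inst L σ' c)
  similar-inst σ σ' h (var x)    = h x
  similar-inst σ σ' h (app a b)  = app (similar-inst σ σ' h a) (similar-inst σ σ' h b)
  similar-inst σ σ' h (fun f as) = fun f (λ k → similar-inst σ σ' h (as k))

  -- Every expansion step consumes one unit of depth on both sides, and the
  -- starting indices are arbitrary, so index differences are harmless.
  transfer : ∀ {B} d → Transfers B d → Transfers (Similar B) d
  transfer d hB zero    i j _ _ = tt
  transfer d hB (suc m) i j (base b) p = hB (suc m) i j b p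
  transfer d hB (suc m) i j (app ra rb) (inj₁ p) = inj₁ (transfer d hB m i j ra p)
  transfer d hB (suc m) i j (app ra rb) (inj₂ p) = inj₂ (transfer d hB m i j rb p)
  transfer d hB (suc m) i j (var x) ()
  transfer d hB (suc m) i j (fun f h) p =
    transfer d hB m (suc i) (suc j)
      (similar-inst _ _ (λ { (inj₁ k) → h k ; (inj₂ _) → v i j }) (scope f)) p
  transfer d hB (suc m) i j (v _ _) ()
  transfer d hB (suc m) i j (lam _ _ r) p = transfer d hB m _ _ r p

  index-independent : ∀ m i j u → Reaches m i u → Reaches m j u
  index-independent m i j u p =
    transfer 0 (λ _ _ _ ()) m i j (similar-refl {λ _ _ → ⊥} u)
      (subst (λ n → Reaches n i u) (sym (+-identityʳ m)) p)

  data Pair (s t : Term L) : XTm L → XTm L → Set where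
    pair : Pair s t (embed L s) (embed L t)

  plug-similar : ∀ s t C →
                 Similar (Pair s t) (embed L (plug L C s)) (embed L (plug L C t))
  plug-similar s t hole            = base pair
  plug-similar s t (appL C u)      = app (plug-similar s t C) (similar-refl _)
  plug-similar s t (appR u C)      = app (similar-refl _) (plug-similar s t C)
  plug-similar s t (funC f i as C) = fun f argument
    where
      argument : ∀ k → Similar (Pair s t) (embed L (updArg L as i (plug L C s) k))
                                          (embed L (updArg L as i (plug L C t) k))
      argument k with k ≟ i
      ... | yes _ = plug-similar s t C
      ... | no _  = similar-refl _

  -- |s|_λ ≤ |t|_λ + d is exactly depth transfer along the pair (s, t),
  -- thanks to index independence.
  pair-transfers : ∀ s t d → DepthLe+ L s t d → Transfers (Pair s t) d
  pair-transfers s t d h m i j pair p =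
    index-independent m 0 j (embed L t) (h m (index-independent (m + d) i 0 (embed L s) p))

  context-DepthLe+ : ∀ C s t d → DepthLe+ L s t d → DepthLe+ L (plug L C s) (plug L C t) d
  context-DepthLe+ C s t d h n =
    transfer d (pair-transfers s t d h) n 0 0 (plug-similar s t C)

  DepthLe+-zero : ∀ s t → (∀ n → DepthGe L n s → DepthGe L n t) → DepthLe+ L s t 0
  DepthLe+-zero s t h n p = h n (subst (λ k → DepthGe L k s) (+-identityʳ n) p)

  DepthLe+-zero⁻¹ : ∀ s t → DepthLe+ L s t 0 → ∀ n → DepthGe L n s → DepthGe L n t
  DepthLe+-zero⁻¹ s t h n p = h n (subst (λ k → DepthGe L k s) (sym (+-identityʳ n)) p)

  context-DepthEq : ∀ C s t → DepthEq L s t → DepthEq L (plug L C s) (plug L C t)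
  context-DepthEq C s t e n = monotone s t (λ k → proj₁ (e k)) , monotone t s (λ k → proj₂ (e k))
    where
      monotone : ∀ a b → (∀ k → DepthGe L k a → DepthGe L k b) →
                 DepthGe L n (plug L C a) → DepthGe L n (plug L C b)
      monotone a b h = DepthLe+-zero⁻¹ (plug L C a) (plug L C b)
                         (context-DepthLe+ C a b 0 (DepthLe+-zero a b h)) n

lemma3p6 : (L : LTRS) → FinitelyNested L →
    (C : Ctx L) (s t : Term L) (d : ℕ) →
    (DepthLe+ L s t d → DepthLe+ L (plug L C s) (plug L C t) d) ×
    (DepthEq L s t → DepthEq L (plug L C s) (plug L C t))
lemma3p6 L _ C s t d = context-DepthLe+ L C s t d , context-DepthEq L C s t
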